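{- For any finite simple undirected graph $G$, $\beta(G) \leq \theta(G)-\tau(G)$.
   Context: The edge space of $G$ is the $\mathbb{F}_2$-vector space of subsets of $E(G)$ under symmetric difference. The cycle space is the subspace of edge sets in which every vertex has even degree; its dimension is the circuit rank $\theta(G)$. The cut space consists of all edge sets $\{uv\in E(G): u\in S, v\notin S\}$ for $S\subseteq V(G)$. The bicycle space is the intersection of the cycle space and the cut space, and $\beta(G)$ is its dimension. A cycle is odd if it has an odd number of edges; two cycles are disjoint if they share no edge; $\tau(G)$ is the maximum cardinality of a set of pairwise disjoint odd cycles of $G$. -}

module Defs where

open import Data.Bool using (Bool; true; false; _∧_; _xor_)
open import Data.Nat using (ℕ; zero; suc; _+_; _≤_; _%_)
open import Data.Nat.DivMod using (_mod_)
open import Data.Fin using (Fin; toℕ) renaming (zero to fz; suc to fs)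
open import Data.Product using (Σ; _×_; _,_; ∃)
open import Data.Sum using (_⊎_)
open import Data.Empty using (⊥)
open import Relation.Binary.PropositionalEquality using (_≡_; _≢_)
open import Function.Definitions using (Injective)

record Graph : Set where
  field
    n     : ℕ
    adj   : Fin n → Fin n → Bool
    sym   : ∀ u v → adj u v ≡ adj v u
    irref : ∀ u → adj u u ≡ false
open Graph public

⊕Σ : (k : ℕ) → (Fin k → Bool) → Bool
⊕Σ zero    f = false
⊕Σ (suc k) f = f fz xor ⊕Σ k (λ i → f (fs i))

-- Elements of the edge space: subsets of E(G), encoded as symmetric
-- Boolean functions on pairs of vertices that are true only on edges.
EdgeFn : Graph → Set
EdgeFn G = Fin (n G) → Fin (n G) → Bool

InEdgeSpace : (G : Graph) → EdgeFn G → Set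
InEdgeSpace G X = (∀ u v → X u v ≡ X v u) × (∀ u v → X u v ≡ true → adj G u v ≡ true)

InCycleSpace : (G : Graph) → EdgeFn G → Set
InCycleSpace G X = InEdgeSpace G X × (∀ v → ⊕Σ (n G) (λ u → X v u) ≡ false)

InCutSpace : (G : Graph) → EdgeFn G → Set
InCutSpace G X = Σ (Fin (n G) → Bool) λ S → ∀ u v → X u v ≡ (adj G u v ∧ (S u xor S v))

InBicycleSpace : (G : Graph) → EdgeFn G → Set
InBicycleSpace G X = InCycleSpace G X × InCutSpace G X

lincomb : {G : Graph} (k : ℕ) → (Fin k → Bool) → (Fin k → EdgeFn G) → EdgeFn G
lincomb k S f u v = ⊕Σ k (λ i → S i ∧ f i u v)

Independent : (G : Graph) (k : ℕ) → (Fin k → EdgeFn G) → Set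
Independent G k f = ∀ (S : Fin k → Bool) →
  (∀ u v → lincomb {G} k S f u v ≡ false) → ∀ i → S i ≡ false

IsDim : (G : Graph) → (EdgeFn G → Set) → ℕ → Set
IsDim G P d =
  (Σ (Fin d → EdgeFn G) λ f → (∀ i → P (f i)) × Independent G d f) ×
  (∀ (k : ℕ) (f : Fin k → EdgeFn G) → (∀ i → P (f i)) → Independent G k f → k ≤ d)

next : {j : ℕ} → Fin (suc j) → Fin (suc j)
next {j} i = suc (toℕ i) mod suc j

record Cycle (G : Graph) : Set where
  field
    m     : ℕ
    vtx   : Fin (3 + m) → Fin (n G)
    inj   : Injective _≡_ _≡_ vtx
    adjac : ∀ i → adj G (vtx i) (vtx (next i)) ≡ true
open Cycle public

cycleLength : {G : Graph} → Cycle G → ℕ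
cycleLength C = 3 + m C

IsOdd : {G : Graph} → Cycle G → Set
IsOdd C = cycleLength C % 2 ≡ 1

UsesEdge : {G : Graph} → Cycle G → Fin (n G) → Fin (n G) → Set
UsesEdge C u v = ∃ λ i →
  (vtx C i ≡ u × vtx C (next i) ≡ v) ⊎ (vtx C i ≡ v × vtx C (next i) ≡ u)

Disjoint : {G : Graph} → Cycle G → Cycle G → Set
Disjoint {G} C D = ∀ u v → UsesEdge C u v → UsesEdge D u v → ⊥

DisjointOddFamily : (G : Graph) (k : ℕ) → (Fin k → Cycle G) → Set
DisjointOddFamily G k F = (∀ i → IsOdd (F i)) × (∀ i j → i ≢ j → Disjoint (F i) (F j))

IsTau : Graph → ℕ → Set
IsTau G t =
  (Σ (Fin t → Cycle G) λ F → DisjointOddFamily G t F) ×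
  (∀ (k : ℕ) (F : Fin k → Cycle G) → DisjointOddFamily G k F → k ≤ t)

-- Let b₁, …, b_β be a basis of the bicycle space and C₁, …, C_τ pairwise
-- edge-disjoint odd cycles. Summing an edge set along the closed walk Cⱼ
-- (its F₂ inner product with E(Cⱼ)) is a linear form which vanishes on every
-- cut, since a closed walk crosses a cut an even number of times, vanishes on
-- E(Cₖ) for k ≠ j by disjointness, and is 1 on E(Cⱼ) because Cⱼ is odd. These
-- forms separate the E(Cⱼ) from each other and from the span of the bᵢ, so
-- b₁, …, b_β, E(C₁), …, E(C_τ) are β + τ independent elements of the cycle
-- space, whence β + τ ≤ θ.
module Submission where

open import Defs hiding (sym)
open import Algebra.Bundles using (CommutativeRing)
open import Data.Bool using (Bool; true; false; _∧_; _xor_)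
open import Data.Bool.Properties
  using ( xor-∧-commutativeRing; xor-comm; xor-assoc; xor-same; xor-identityʳ
        ; ∧-zeroʳ; ∧-identityʳ; not-involutive; ¬-not)
open import Data.Fin using (Fin; toℕ; fromℕ; inject₁; punchIn; _↑ˡ_; _↑ʳ_; splitAt; join; _≟_)
  renaming (zero to fz; suc to fs)
open import Data.Fin.Properties
  using (toℕ-injective; toℕ-fromℕ; toℕ-fromℕ<; toℕ-inject₁; toℕ-inject₁-≢; toℕ<n; punchInᵢ≢i; join-splitAt)
open import Data.Nat using (ℕ; zero; suc; _+_; _%_; _≤_; _∸_; s<s)
open import Data.Nat.DivMod using (m<n⇒m%n≡m; n%n≡0)
open import Data.Nat.Properties using (≤∧≢⇒<; ≤-pred; 0≢1+n; m≢1+n+m; m+n≤o⇒m≤o∸n)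
  renaming (_≟_ to _≟ℕ_)
open import Data.Product using (∃; _×_; _,_; proj₁; proj₂)
import Data.Product as Product
open import Data.Sum using (_⊎_; inj₁; inj₂)
import Data.Sum as Sum
open import Data.Vec.Functional using (_++_)
open import Data.Vec.Functional.Properties using (lookup-++ˡ; lookup-++ʳ)
open import Data.Vec.Functional.Relation.Unary.All.Properties using (++⁺)
open import Function using (_∘_; case_of_)
open import Relation.Binary.PropositionalEquality
  using (_≡_; _≢_; refl; sym; trans; cong; cong₂; subst; module ≡-Reasoning)
open import Relation.Nullary using (yes; no; does)
open import Relation.Nullary.Decidable using (dec-true; dec-false)

open ≡-Reasoning
open CommutativeRing xor-∧-commutativeRing using (semiring)
open import Algebra.Properties.Semiring.Sum semiring
  using ( sum; sum-cong-≗; sum-replicate-zero; sum-remove; sum-init-last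
        ; ∑-distrib-+; ∑-comm; *-distribˡ-sum; *-distribʳ-sum)

xor-true⇒ : ∀ {x y} → x xor y ≡ true → x ≡ true ⊎ y ≡ true
xor-true⇒ {true}  _     = inj₁ refl
xor-true⇒ {false} y≡true = inj₂ y≡true

∧-true⇒ : ∀ {x y} → x ∧ y ≡ true → x ≡ true × y ≡ true
∧-true⇒ {true} {true} _ = refl , refl

xor≡false⇒≡ : ∀ {x y} → x xor y ≡ false → x ≡ y
xor≡false⇒≡ {true}  {true}  _ = refl
xor≡false⇒≡ {false} {false} _ = refl

_==_ : ∀ {N} → Fin N → Fin N → Bool
a == b = does (a ≟ b)

==-refl : ∀ {N} (a : Fin N) → (a == a) ≡ true
==-refl a = dec-true (a ≟ a) refl

==-≢ : ∀ {N} {a b : Fin N} → a ≢ b → (a == b) ≡ false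
==-≢ {a = a} {b} = dec-false (a ≟ b)

==⇒≡ : ∀ {N} {a b : Fin N} → (a == b) ≡ true → a ≡ b
==⇒≡ {a = a} {b} _ with a ≟ b
... | yes a≡b = a≡b

⊕Σ≡sum : ∀ k (f : Fin k → Bool) → ⊕Σ k f ≡ sum f
⊕Σ≡sum zero    f = refl
⊕Σ≡sum (suc k) f = cong (f fz xor_) (⊕Σ≡sum k (f ∘ fs))

sum-zero : ∀ {k} {f : Fin k → Bool} → (∀ i → f i ≡ false) → sum f ≡ false
sum-zero {k} f≗false = trans (sum-cong-≗ f≗false) (sum-replicate-zero k)

sum-single : ∀ {k} (f : Fin k → Bool) i → (∀ j → j ≢ i → f j ≡ false) → sum f ≡ f i
sum-single {suc k} f i off-i = begin
  sum f                        ≡⟨ sum-remove f ⟩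
  f i xor sum (f ∘ punchIn i)  ≡⟨ cong (f i xor_) (sum-zero (λ j → off-i _ (punchInᵢ≢i i j))) ⟩
  f i xor false                ≡⟨ xor-identityʳ (f i) ⟩
  f i                          ∎

sum-== : ∀ {N} (a : Fin N) → sum (a ==_) ≡ true
sum-== a = trans (sum-single (a ==_) a (λ b b≢a → ==-≢ (b≢a ∘ sym))) (==-refl a)

sum-true⇒∃ : ∀ {k} (f : Fin k → Bool) → sum f ≡ true → ∃ λ i → f i ≡ true
sum-true⇒∃ {suc k} f ∑f≡true with f fz in f0≡
... | true  = fz , f0≡
... | false with sum-true⇒∃ (f ∘ fs) ∑f≡true
...   | i , fᵢ≡true = fs i , fᵢ≡true

sum-++ : ∀ {m n} (f : Fin (m + n) → Bool) →
         sum f ≡ sum (λ i → f (i ↑ˡ n)) xor sum (λ j → f (m ↑ʳ j))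
sum-++ {zero}      f = refl
sum-++ {suc m} {n} f =
  trans (cong (f fz xor_) (sum-++ {m} {n} (f ∘ fs))) (sym (xor-assoc (f fz) _ _))

sum-replicate-true-odd : ∀ k → k % 2 ≡ 1 → sum {k} (λ _ → true) ≡ true
sum-replicate-true-odd 1             _   = refl
sum-replicate-true-odd (suc (suc k)) odd = trans (not-involutive _) (sum-replicate-true-odd k odd)

next-suc : ∀ {k} (i : Fin (suc k)) → toℕ i ≢ k → toℕ (next i) ≡ suc (toℕ i)
next-suc i i≢k = trans (toℕ-fromℕ< _) (m<n⇒m%n≡m (s<s (≤∧≢⇒< (≤-pred (toℕ<n i)) i≢k)))

next-wrap : ∀ {k} (i : Fin (suc k)) → toℕ i ≡ k → toℕ (next i) ≡ 0
next-wrap {k} i i≡k =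
  trans (toℕ-fromℕ< _) (trans (cong (λ t → suc t % suc k) i≡k) (n%n≡0 (suc k)))

next-inject₁ : ∀ {k} (j : Fin k) → next (inject₁ j) ≡ fs j
next-inject₁ j = toℕ-injective
  (trans (next-suc (inject₁ j) (toℕ-inject₁-≢ j ∘ sym)) (cong suc (toℕ-inject₁ j)))

next-fromℕ : ∀ k → next (fromℕ k) ≡ fz
next-fromℕ k = toℕ-injective (next-wrap (fromℕ k) (toℕ-fromℕ k))

next²≢id : ∀ {m} (i : Fin (3 + m)) → next (next i) ≢ i
next²≢id {m} i next²i≡i with toℕ i ≟ℕ 2 + m | toℕ (next i) ≟ℕ 2 + m
... | yes i≡k | _ with () ← begin
  1                          ≡⟨ cong suc (next-wrap i i≡k) ⟨
  suc (toℕ (next i))         ≡⟨ next-suc (next i) (0≢1+n ∘ trans (sym (next-wrap i i≡k))) ⟨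
  toℕ (next (next i))        ≡⟨ cong toℕ next²i≡i ⟩
  toℕ i                      ≡⟨ i≡k ⟩
  2 + m                      ∎
... | no i≢k | yes nextᵢ≡k with () ← begin
  2 + m                      ≡⟨ nextᵢ≡k ⟨
  toℕ (next i)               ≡⟨ next-suc i i≢k ⟩
  suc (toℕ i)                ≡⟨ cong (suc ∘ toℕ) next²i≡i ⟨
  suc (toℕ (next (next i)))  ≡⟨ cong suc (next-wrap (next i) nextᵢ≡k) ⟩
  1                          ∎
... | no i≢k | no nextᵢ≢k = m≢1+n+m (toℕ i) (begin
  toℕ i                      ≡⟨ cong toℕ next²i≡i ⟨
  toℕ (next (next i))        ≡⟨ next-suc (next i) nextᵢ≢k ⟩
  suc (toℕ (next i))         ≡⟨ cong suc (next-suc i i≢k) ⟩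
  suc (suc (toℕ i))          ∎)

sum-rotate : ∀ {k} (f : Fin (suc k) → Bool) → sum (f ∘ next) ≡ sum f
sum-rotate {k} f = begin
  sum (f ∘ next)                                   ≡⟨ sum-init-last (f ∘ next) ⟩
  sum (f ∘ next ∘ inject₁) xor f (next (fromℕ k))  ≡⟨ cong₂ _xor_ (sum-cong-≗ (cong f ∘ next-inject₁))
                                                                   (cong f (next-fromℕ k)) ⟩
  sum (f ∘ fs) xor f fz                            ≡⟨ xor-comm _ (f fz) ⟩
  sum f                                            ∎

sum-telescope : ∀ {k} (f : Fin (suc k) → Bool) → sum (λ i → f i xor f (next i)) ≡ false
sum-telescope f = begin
  sum (λ i → f i xor f (next i))  ≡⟨ ∑-distrib-+ f (f ∘ next) ⟩
  sum f xor sum (f ∘ next)        ≡⟨ cong (sum f xor_) (sum-rotate f) ⟩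
  sum f xor sum f                 ≡⟨ xor-same (sum f) ⟩
  false                           ∎

edge : ∀ {N} → Fin N → Fin N → Fin N → Fin N → Bool
edge a b u v = (a == u ∧ b == v) xor (a == v ∧ b == u)

edge-sym : ∀ {N} (a b u v : Fin N) → edge a b u v ≡ edge a b v u
edge-sym a b u v = xor-comm (a == u ∧ b == v) (a == v ∧ b == u)

edge-true⇒ : ∀ {N} {a b u v : Fin N} → edge a b u v ≡ true → (a ≡ u × b ≡ v) ⊎ (a ≡ v × b ≡ u)
edge-true⇒ = Sum.map both both ∘ xor-true⇒
  where
  both : ∀ {N} {a b c d : Fin N} → (a == c ∧ b == d) ≡ true → a ≡ c × b ≡ d
  both = Product.map ==⇒≡ ==⇒≡ ∘ ∧-true⇒

edge-self : ∀ {N} {a b : Fin N} → a ≢ b → edge a b a b ≡ true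
edge-self {a = a} {b} a≢b rewrite ==-refl a | ==-refl b | ==-≢ a≢b = refl

degree-edge : ∀ {N} (a b v : Fin N) → sum (edge a b v) ≡ (a == v) xor (b == v)
degree-edge {N} a b v = begin
  sum (edge a b v)
    ≡⟨ ∑-distrib-+ {N} _ _ ⟩
  sum (λ u → a == v ∧ b == u) xor sum (λ u → a == u ∧ b == v)
    ≡⟨ cong₂ _xor_ (*-distribˡ-sum (a == v) (b ==_)) (*-distribʳ-sum (b == v) (a ==_)) ⟨
  (a == v ∧ sum (b ==_)) xor (sum (a ==_) ∧ b == v)
    ≡⟨ cong₂ (λ x y → (a == v ∧ x) xor (y ∧ b == v)) (sum-== b) (sum-== a) ⟩
  (a == v ∧ true) xor (b == v)
    ≡⟨ cong (_xor (b == v)) (∧-identityʳ (a == v)) ⟩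
  (a == v) xor (b == v)
    ∎

lincomb≡sum : ∀ {G} k S (f : Fin k → EdgeFn G) u v →
              lincomb {G} k S f u v ≡ sum (λ i → S i ∧ f i u v)
lincomb≡sum k S f u v = ⊕Σ≡sum k _

lincomb-++ : ∀ {G β τ} S (b : Fin β → EdgeFn G) (e : Fin τ → EdgeFn G) u v →
  lincomb {G} (β + τ) S (b ++ e) u v ≡
  lincomb {G} β (S ∘ (_↑ˡ τ)) b u v xor lincomb {G} τ (S ∘ (β ↑ʳ_)) e u v
lincomb-++ {G} {β} {τ} S b e u v = begin
  lincomb {G} (β + τ) S (b ++ e) u v
    ≡⟨ lincomb≡sum {G} (β + τ) S (b ++ e) u v ⟩
  sum (λ i → S i ∧ (b ++ e) i u v)
    ≡⟨ sum-++ {β} {τ} _ ⟩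
  sum (λ i → S (i ↑ˡ τ) ∧ (b ++ e) (i ↑ˡ τ) u v) xor sum (λ j → S (β ↑ʳ j) ∧ (b ++ e) (β ↑ʳ j) u v)
    ≡⟨ cong₂ _xor_ (sum-cong-≗ λ i → cong (λ x → S (i ↑ˡ τ) ∧ x u v) (lookup-++ˡ b e i))
                   (sum-cong-≗ λ j → cong (λ x → S (β ↑ʳ j) ∧ x u v) (lookup-++ʳ b e j)) ⟩
  sum (λ i → S (i ↑ˡ τ) ∧ b i u v) xor sum (λ j → S (β ↑ʳ j) ∧ e j u v)
    ≡⟨ cong₂ _xor_ (lincomb≡sum {G} β _ b u v) (lincomb≡sum {G} τ _ e u v) ⟨
  lincomb {G} β (S ∘ (_↑ˡ τ)) b u v xor lincomb {G} τ (S ∘ (β ↑ʳ_)) e u v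
    ∎

IsLinearForm : (G : Graph) → (EdgeFn G → Bool) → Set
IsLinearForm G φ =
  (∀ {X Y} → (∀ u v → X u v ≡ Y u v) → φ X ≡ φ Y) ×
  (∀ k S (f : Fin k → EdgeFn G) → φ (lincomb {G} k S f) ≡ sum (λ i → S i ∧ φ (f i)))

independent-++ : ∀ {G β τ} (b : Fin β → EdgeFn G) (e : Fin τ → EdgeFn G)
  (φ : Fin τ → EdgeFn G → Bool) → (∀ j → IsLinearForm G (φ j)) →
  (∀ j i → φ j (b i) ≡ false) → (∀ j j′ → φ j (e j′) ≡ (j == j′)) →
  Independent G β b → Independent G (β + τ) (b ++ e)
independent-++ {G} {β} {τ} b e φ φ-linear φb≡0 φe≡δ b-independent S ∑S[b++e]≡0 i =
  subst (λ i → S i ≡ false) (join-splitAt β τ i) (S∘join≡0 (splitAt β i))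
  where
  S₁ = S ∘ (_↑ˡ τ)
  S₂ = S ∘ (β ↑ʳ_)
  X Y : EdgeFn G
  X = lincomb {G} β S₁ b
  Y = lincomb {G} τ S₂ e
  X≗Y : ∀ u v → X u v ≡ Y u v
  X≗Y u v = xor≡false⇒≡ (trans (sym (lincomb-++ {G} S b e u v)) (∑S[b++e]≡0 u v))
  S₂≡0 : ∀ j → S₂ j ≡ false
  S₂≡0 j = begin
    S₂ j                             ≡⟨ ∧-identityʳ (S₂ j) ⟨
    S₂ j ∧ true                      ≡⟨ cong (S₂ j ∧_) (==-refl j) ⟨
    S₂ j ∧ (j == j)                  ≡⟨ sum-single (λ j′ → S₂ j′ ∧ (j == j′)) j off-diagonal ⟨
    sum (λ j′ → S₂ j′ ∧ (j == j′))   ≡⟨ sum-cong-≗ (λ j′ → cong (S₂ j′ ∧_) (φe≡δ j j′)) ⟨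
    sum (λ j′ → S₂ j′ ∧ φ j (e j′))  ≡⟨ proj₂ (φ-linear j) τ S₂ e ⟨
    φ j Y                            ≡⟨ proj₁ (φ-linear j) X≗Y ⟨
    φ j X                            ≡⟨ proj₂ (φ-linear j) β S₁ b ⟩
    sum (λ i → S₁ i ∧ φ j (b i))     ≡⟨ sum-zero (λ i → trans (cong (S₁ i ∧_) (φb≡0 j i)) (∧-zeroʳ (S₁ i))) ⟩
    false                            ∎
    where
    off-diagonal : ∀ j′ → j′ ≢ j → S₂ j′ ∧ (j == j′) ≡ false
    off-diagonal j′ j′≢j = trans (cong (S₂ j′ ∧_) (==-≢ (j′≢j ∘ sym))) (∧-zeroʳ (S₂ j′))
  S₁≡0 : ∀ i → S₁ i ≡ false
  S₁≡0 = b-independent S₁ λ u v → trans (X≗Y u v)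
    (trans (lincomb≡sum {G} τ S₂ e u v) (sum-zero λ j → cong (_∧ e j u v) (S₂≡0 j)))
  S∘join≡0 : ∀ s → S (join β τ s) ≡ false
  S∘join≡0 (inj₁ i) = S₁≡0 i
  S∘join≡0 (inj₂ j) = S₂≡0 j

module _ {G : Graph} where

  edgesOf : Cycle G → EdgeFn G
  edgesOf C u v = sum (λ i → edge (vtx C i) (vtx C (next i)) u v)

  sumAlong : Cycle G → EdgeFn G → Bool
  sumAlong C X = sum (λ i → X (vtx C i) (vtx C (next i)))

  adj⇒≢ : ∀ {u v} → adj G u v ≡ true → u ≢ v
  adj⇒≢ {u} uu∈E refl with () ← trans (sym uu∈E) (irref G u)

  usesEdge⇒adj : (C : Cycle G) → ∀ {u v} → UsesEdge C u v → adj G u v ≡ true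
  usesEdge⇒adj C (i , inj₁ (refl , refl)) = adjac C i
  usesEdge⇒adj C (i , inj₂ (refl , refl)) = trans (Graph.sym G _ _) (adjac C i)

  edgesOf⇒usesEdge : (C : Cycle G) → ∀ {u v} → edgesOf C u v ≡ true → UsesEdge C u v
  edgesOf⇒usesEdge C uv∈C with sum-true⇒∃ _ uv∈C
  ... | i , uv≡cᵢcᵢ₊₁ = i , edge-true⇒ uv≡cᵢcᵢ₊₁

  edgesOf-inCycleSpace : (C : Cycle G) → InCycleSpace G (edgesOf C)
  edgesOf-inCycleSpace C = (symmetric , λ u v → usesEdge⇒adj C ∘ edgesOf⇒usesEdge C) , even-degree
    where
    c = vtx C
    symmetric : ∀ u v → edgesOf C u v ≡ edgesOf C v u
    symmetric u v = sum-cong-≗ λ i → edge-sym (c i) (c (next i)) u v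
    even-degree : ∀ v → ⊕Σ (n G) (edgesOf C v) ≡ false
    even-degree v = begin
      ⊕Σ (n G) (edgesOf C v)                              ≡⟨ ⊕Σ≡sum (n G) _ ⟩
      sum (λ u → sum (λ i → edge (c i) (c (next i)) v u)) ≡⟨ ∑-comm (λ u i → edge (c i) (c (next i)) v u) ⟩
      sum (λ i → sum (edge (c i) (c (next i)) v))         ≡⟨ sum-cong-≗ (λ i → degree-edge (c i) (c (next i)) v) ⟩
      sum (λ i → (c i == v) xor (c (next i) == v))        ≡⟨ sum-telescope (λ i → c i == v) ⟩
      false                                               ∎

  sumAlong-linear : (C : Cycle G) → IsLinearForm G (sumAlong C)
  sumAlong-linear C = (λ X≗Y → sum-cong-≗ λ i → X≗Y (c i) (c (next i))) , linear
    where
    c = vtx C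
    linear : ∀ k S (f : Fin k → EdgeFn G) →
             sumAlong C (lincomb {G} k S f) ≡ sum (λ j → S j ∧ sumAlong C (f j))
    linear k S f = begin
      sumAlong C (lincomb {G} k S f)                    ≡⟨ sum-cong-≗ (λ i → lincomb≡sum {G} k S f (c i) (c (next i))) ⟩
      sum (λ i → sum (λ j → S j ∧ f j (c i) (c (next i)))) ≡⟨ ∑-comm (λ i j → S j ∧ f j (c i) (c (next i))) ⟩
      sum (λ j → sum (λ i → S j ∧ f j (c i) (c (next i)))) ≡⟨ sum-cong-≗ (λ j → *-distribˡ-sum (S j) (λ i → f j (c i) (c (next i)))) ⟨
      sum (λ j → S j ∧ sumAlong C (f j))                ∎

  sumAlong-cut : (C : Cycle G) → ∀ {X} → InCutSpace G X → sumAlong C X ≡ false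
  sumAlong-cut C {X} (S , X≡δS) = begin
    sumAlong C X                                ≡⟨ sum-cong-≗ crossing ⟩
    sum (λ i → S (c i) xor S (c (next i)))      ≡⟨ sum-telescope (S ∘ c) ⟩
    false                                       ∎
    where
    c = vtx C
    crossing : ∀ i → X (c i) (c (next i)) ≡ S (c i) xor S (c (next i))
    crossing i = trans (X≡δS _ _) (cong (_∧ (S (c i) xor S (c (next i)))) (adjac C i))

  sumAlong-disjoint : (C D : Cycle G) → Disjoint C D → sumAlong C (edgesOf D) ≡ false
  sumAlong-disjoint C D C∩D≡∅ = sum-zero λ i → ¬-not λ cᵢcᵢ₊₁∈D →
    C∩D≡∅ _ _ (i , inj₁ (refl , refl)) (edgesOf⇒usesEdge D cᵢcᵢ₊₁∈D)

  sumAlong-self : (C : Cycle G) → IsOdd C → sumAlong C (edgesOf C) ≡ true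
  sumAlong-self C odd = trans (sum-cong-≗ traversed-once) (sum-replicate-true-odd (3 + m C) odd)
    where
    c = vtx C
    -- Traversing cᵢcᵢ₊₁ backwards at step i′ would force next (next i) ≡ i,
    -- which the length ≥ 3 of a cycle rules out.
    other-step : ∀ i i′ → i′ ≢ i → edge (c i′) (c (next i′)) (c i) (c (next i)) ≡ false
    other-step i i′ i′≢i = ¬-not λ same-edge → case edge-true⇒ same-edge of λ where
      (inj₁ (cᵢ′≡cᵢ , _))          → i′≢i (inj C cᵢ′≡cᵢ)
      (inj₂ (cᵢ′≡cᵢ₊₁ , cᵢ′₊₁≡cᵢ)) →
        next²≢id i (trans (cong next (sym (inj C cᵢ′≡cᵢ₊₁))) (inj C cᵢ′₊₁≡cᵢ))
    traversed-once : ∀ i → edgesOf C (c i) (c (next i)) ≡ true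
    traversed-once i = trans (sum-single _ i (other-step i)) (edge-self (adj⇒≢ (adjac C i)))

  sumAlong-edgesOf : ∀ {τ} (F : Fin τ → Cycle G) → DisjointOddFamily G τ F →
                     ∀ j j′ → sumAlong (F j) (edgesOf (F j′)) ≡ (j == j′)
  sumAlong-edgesOf F (odd , disjoint) j j′ with j ≟ j′
  ... | yes refl = sumAlong-self (F j) (odd j)
  ... | no j≢j′  = sumAlong-disjoint (F j) (F j′) (disjoint j j′ j≢j′)

lemma4 : (G : Graph) (β θ τ : ℕ) →
    IsDim G (InBicycleSpace G) β →
    IsDim G (InCycleSpace G) θ →
    IsTau G τ →
    β ≤ θ ∸ τ
lemma4 G β θ τ ((b , b-bicycles , b-independent) , _) (_ , θ-maximal) ((F , F-disjoint-odd) , _) =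
  m+n≤o⇒m≤o∸n β (θ-maximal (β + τ) (b ++ e) b++e-cycles b++e-independent)
  where
  e : Fin τ → EdgeFn G
  e = edgesOf ∘ F
  b++e-cycles : ∀ i → InCycleSpace G ((b ++ e) i)
  b++e-cycles = ++⁺ (InCycleSpace G) (proj₁ ∘ b-bicycles) (edgesOf-inCycleSpace ∘ F)
  b++e-independent : Independent G (β + τ) (b ++ e)
  b++e-independent = independent-++ {G} b e (sumAlong ∘ F) (sumAlong-linear ∘ F)
    (λ j i → sumAlong-cut (F j) (proj₂ (b-bicycles i)))
    (sumAlong-edgesOf F F-disjoint-odd)
    b-independent
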